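{- Let $\mathcal{G}=(V_\mathcal{G},E^+_\mathcal{G},E^-_\mathcal{G},L_\mathcal{G})$ be a signed graph with $V_\mathcal{G}=[n]$. Then the following are equivalent: (i) $\mathcal{G}$ has an even (respectively, odd) full cyclic permutation ordering; (ii) the unsigned multigraph $\bar{\mathcal{G}}$ has a full cyclic permutation ordering and $|L_\mathcal{G}|$ is even (respectively, odd).
   Context: Let $n\ge1$, $[n]=\{1,\dots,n\}$, $I_n=\{ -n,\dots,-1,1,\dots,n\}$. The hyperoctahedral group is $\mathfrak{H}_n=\{\eta\in\mathfrak{S}_{I_n}:\eta(-i)=-\eta(i)\ \forall i\in I_n\}$; $\mathfrak{S}_n$ is regarded as a subgroup of $\mathfrak{H}_n$ (a permutation $\sigma$ of $[n]$ extended by $\sigma(-i)=-\sigma(i)$). Signed transpositions: for distinct $i,j\in[n]$, $(i\ j)$ swaps $i\leftrightarrow j$ (and $-i\leftrightarrow -j$), fixing everything else; $(i\ { -j})$ sends $i\mapsto -j$, $j\mapsto -i$ (and correspondingly on negatives), fixing everything else; for $i\in[n]$, the inversion transposition $(i\ { -i})$ sends $i\mapsto -i$ and fixes all other elements of $[n]$. An element $\eta\in\mathfrak{H}_n$ is an even (resp. odd) full cyclic permutation if there are an ordering $i_1,\dots,i_n$ of $[n]$ and signs $\epsilon_1,\dots,\epsilon_n\in\{+1,-1\}$ with $\eta(i_k)=\epsilon_k i_{k+1}$ for all $k$ (indices mod $n$, $i_{n+1}=i_1$) and $\epsilon_1\cdots\epsilon_n=+1$ (resp. $-1$). A signed graph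 is a quadruple $\mathcal{G}=(V_\mathcal{G},E^+_\mathcal{G},E^-_\mathcal{G},L_\mathcal{G})$ with $V_\mathcal{G}=[n]$, $E^+_\mathcal{G},E^-_\mathcal{G}$ sets of 2-element subsets of $V_\mathcal{G}$ (positive and negative edges), and $L_\mathcal{G}\subseteq V_\mathcal{G}$ (loops); its edge set is the disjoint union $E_\mathcal{G}=E^+_\mathcal{G}\sqcup E^-_\mathcal{G}\sqcup L_\mathcal{G}$. To $e\in E_\mathcal{G}$ associate $\tau_e=(i\ j)$ if $e=\{i,j\}\in E^+_\mathcal{G}$, $\tau_e=(i\ { -j})$ if $e=\{i,j\}\in E^-_\mathcal{G}$, $\tau_e=(i\ { -i})$ if $e=i\in L_\mathcal{G}$. An edge ordering is a linear order $\omega=(e_1,\dots,e_m)$ of $E_\mathcal{G}$, and $\pi_\omega=\tau_{e_m}\cdots\tau_{e_1}\in\mathfrak{H}_n$ (composition of maps). $\omega$ is an even (resp. odd) full cyclic permutation ordering if $\pi_\omega$ is an even (resp. odd) full cyclic permutation. $\bar{\mathcal{G}}$ denotes the unsigned multigraph on vertex set $[n]$ whose edge multiset is $E^+_\mathcal{G}\sqcup E^-_\mathcal{G}$. For an unsigned (multi)graph, each edge $\{i,j\}$ gives the transposition $(i\ j)\in\mathfrak{S}_n$, an edge ordering $(e_1,\dots,e_m)$ gives the product $\tau_{e_m}\cdots\tau_{e_1}\in\mathfrak{S}_n$, and the ordering is a full cyclic permutation ordering if this product is a cycle of length $n$. -}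

module Defs where

open import Data.Nat using (ℕ; zero; suc; NonZero)
open import Data.Nat.DivMod using (_mod_)
open import Data.Fin using (Fin; toℕ; _≟_; _<_)
open import Data.Fin.Permutation using (Permutation′; _⟨$⟩ʳ_)
open import Data.Product using (Σ; Σ-syntax; _×_; _,_; proj₁; proj₂)
open import Data.List using (List; []; _∷_; _++_; map; foldr; allFin)
open import Data.List.Relation.Unary.All using (All)
open import Data.List.Relation.Unary.Unique.Propositional using (Unique)
open import Relation.Binary.PropositionalEquality using (_≡_)
open import Relation.Nullary using (yes; no)

data Sign : Set where
  plus minus : Sign

_·_ : Sign → Sign → Sign
plus  · s = s
minus · plus = minus
minus · minus = plus

signPow : ℕ → Sign
signPow zero    = plus
signPow (suc k) = minus · signPow k

-- Hyperoctahedral group H_n.  An element η is determined by its values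
-- on [n] = Fin n : η(i) = s · j  is encoded as  (s , j);  on negatives
-- η(-i) = -η(i).

SignedPerm : ℕ → Set
SignedPerm n = Fin n → Sign × Fin n

idH : ∀ {n} → SignedPerm n
idH k = plus , k

_⊙_ : ∀ {n} → SignedPerm n → SignedPerm n → SignedPerm n
(η ⊙ θ) k with θ k
... | s , j with η j
...   | t , l = s · t , l

tpos : ∀ {n} → Fin n → Fin n → SignedPerm n
tpos i j k with k ≟ i
... | yes _ = plus , j
... | no _ with k ≟ j
...   | yes _ = plus , i
...   | no _  = plus , k

tneg : ∀ {n} → Fin n → Fin n → SignedPerm n
tneg i j k with k ≟ i
... | yes _ = minus , j
... | no _ with k ≟ j
...   | yes _ = minus , i
...   | no _  = plus , k

tloop : ∀ {n} → Fin n → SignedPerm n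
tloop i k with k ≟ i
... | yes _ = minus , i
... | no _  = plus , k

next : ∀ {n} .{{_ : NonZero n}} → Fin n → Fin n
next {n} k = suc (toℕ k) mod n

signProd : ∀ {n} → (Fin n → Sign) → Sign
signProd {n} ε = foldr (λ k s → ε k · s) plus (allFin n)

-- η is a full cyclic permutation of parity p (plus = even, minus = odd):
-- an ordering i_1..i_n of [n] (a permutation σ with i_k = σ k) and signs
-- ε with η(i_k) = ε_k i_{k+1} (indices mod n) and ε_1⋯ε_n = p.
IsFullCyclicH : ∀ {n} .{{_ : NonZero n}} → SignedPerm n → Sign → Set
IsFullCyclicH {n} η p =
  Σ[ σ ∈ Permutation′ n ] Σ[ ε ∈ (Fin n → Sign) ]
    ((∀ k → η (σ ⟨$⟩ʳ k) ≡ (ε k , σ ⟨$⟩ʳ next k)) × signProd ε ≡ p)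

Perm : ℕ → Set
Perm n = Fin n → Fin n

swap : ∀ {n} → Fin n → Fin n → Perm n
swap i j k with k ≟ i
... | yes _ = j
... | no _ with k ≟ j
...   | yes _ = i
...   | no _  = k

IsFullCyclic : ∀ {n} .{{_ : NonZero n}} → Perm n → Set
IsFullCyclic {n} π =
  Σ[ σ ∈ Permutation′ n ] (∀ k → π (σ ⟨$⟩ʳ k) ≡ σ ⟨$⟩ʳ next k)

-- Signed graphs on [n].  A 2-element subset {i,j} is stored as (i , j)
-- with i < j; sets are duplicate-free lists.

record SignedGraph (n : ℕ) : Set where
  field
    Epos   : List (Fin n × Fin n)
    Eneg   : List (Fin n × Fin n)
    Loops  : List (Fin n)
    Epos-< : All (λ e → proj₁ e < proj₂ e) Epos
    Eneg-< : All (λ e → proj₁ e < proj₂ e) Eneg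
    Epos-u : Unique Epos
    Eneg-u : Unique Eneg
    Loops-u : Unique Loops

data SEdge (n : ℕ) : Set where
  pos  : Fin n → Fin n → SEdge n
  neg  : Fin n → Fin n → SEdge n
  loop : Fin n → SEdge n

edges : ∀ {n} → SignedGraph n → List (SEdge n)
edges G = map (λ e → pos (proj₁ e) (proj₂ e)) (SignedGraph.Epos G)
       ++ map (λ e → neg (proj₁ e) (proj₂ e)) (SignedGraph.Eneg G)
       ++ map loop (SignedGraph.Loops G)

τ : ∀ {n} → SEdge n → SignedPerm n
τ (pos i j) = tpos i j
τ (neg i j) = tneg i j
τ (loop i)  = tloop i

πH : ∀ {n} → List (SEdge n) → SignedPerm n
πH []       = idH
πH (e ∷ es) = πH es ⊙ τ e

-- edge multiset of the unsigned multigraph Ḡ : E⁺ ⊔ E⁻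
unsignedEdges : ∀ {n} → SignedGraph n → List (Fin n × Fin n)
unsignedEdges G = SignedGraph.Epos G ++ SignedGraph.Eneg G

πS : ∀ {n} → List (Fin n × Fin n) → Perm n
πS []       k = k
πS (e ∷ es) k = πS es (swap (proj₁ e) (proj₂ e) k)

-- Forgetting the signs of a signed permutation η gives a permutation |η| of [n], and the
-- product of the signs in η(1), …, η(n) is a homomorphism H_n → {±1}.  Hence π_ω is an even
-- (odd) full cyclic permutation iff |π_ω| is an n-cycle and π_ω has total sign +1 (−1).
-- Now |π_ω| is the product of the unsigned transpositions of the non-loop edges in the same
-- order (inversions act trivially on [n]), while (i j) and (i −j) have total sign +1 and
-- (i −i) has total sign −1, so the total sign of π_ω is (−1)^|L|.  Conversely every ordering
-- of the edges of Ḡ lifts to an ordering of the signed non-loop edges, to which the loops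
-- can be appended.
module Submission where

open import Defs
open import Level using (0ℓ)
open import Algebra.Bundles using (CommutativeMonoid)
open import Data.Nat using (ℕ; NonZero; zero; suc)
open import Data.Fin using (Fin; zero; suc; _≟_; punchIn)
open import Data.Fin.Properties using (<⇒≢; punchInᵢ≢i)
open import Data.Fin.Permutation as Permutation using (Permutation′; _⟨$⟩ʳ_; transpose)
open import Data.Product using (Σ-syntax; _×_; _,_; proj₁; proj₂; uncurry)
open import Data.Maybe using (Maybe; just; nothing)
open import Data.Unit using (⊤; tt)
open import Data.List using (List; []; _∷_; _++_; length; map; foldr; tabulate; mapMaybe)
open import Data.List.Properties using (map-++; map-∘; map-id; mapMaybe-++; mapMaybe-map;
  mapMaybe-just; mapMaybe-nothing; ++-assoc; ++-identityʳ)
open import Data.List.Relation.Unary.All using (All; []; _∷_; universal)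
  renaming (map to All-map)
import Data.List.Relation.Unary.All.Properties as All
open import Data.List.Relation.Binary.Permutation.Propositional using (_↭_; ↭-sym)
open import Data.List.Relation.Binary.Permutation.Propositional.Properties
  using (All-resp-↭; ↭-length; ++⁺ʳ; map⁺; ↭-map-inv; mapMaybe-↭)
open import Relation.Binary.PropositionalEquality
  using (_≡_; refl; sym; trans; cong; cong₂; subst; isEquivalence; _≢_; _≗_; module ≡-Reasoning)
open import Relation.Nullary using (yes; no; contradiction)
open import Function.Base using (_∘_; id)
open import Function.Bundles using (_⇔_; mk⇔; Equivalence)

·-assoc : ∀ a b c → (a · b) · c ≡ a · (b · c)
·-assoc plus  b     c     = refl
·-assoc minus plus  c     = refl
·-assoc minus minus plus  = refl
·-assoc minus minus minus = refl

·-comm : ∀ a b → a · b ≡ b · a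
·-comm plus  plus  = refl
·-comm plus  minus = refl
·-comm minus plus  = refl
·-comm minus minus = refl

·-identityʳ : ∀ a → a · plus ≡ a
·-identityʳ plus  = refl
·-identityʳ minus = refl

·-commutativeMonoid : CommutativeMonoid 0ℓ 0ℓ
·-commutativeMonoid = record
  { Carrier = Sign ; _≈_ = _≡_ ; _∙_ = _·_ ; ε = plus
  ; isCommutativeMonoid = record
    { isMonoid = record
      { isSemigroup = record
        { isMagma = record { isEquivalence = isEquivalence ; ∙-cong = cong₂ _·_ }
        ; assoc = ·-assoc }
      ; identity = (λ _ → refl) , ·-identityʳ }
    ; comm = ·-comm } }

open import Algebra.Properties.CommutativeMonoid.Sum ·-commutativeMonoid
  using () renaming
  (sum to prod; sum-cong-≗ to prod-cong; sum-permute to prod-permute;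
   ∑-distrib-+ to prod-distrib-·; sum-remove to prod-remove; sum-replicate-zero to prod-replicate-plus)

signProd≡prod : ∀ {n} (ε : Fin n → Sign) → signProd ε ≡ prod ε
signProd≡prod {n} ε = foldr-tabulate id
  where
  foldr-tabulate : ∀ {m} (f : Fin m → Fin n) → foldr (λ k s → ε k · s) plus (tabulate f) ≡ prod (ε ∘ f)
  foldr-tabulate {zero}  f = refl
  foldr-tabulate {suc m} f = cong (ε (f zero) ·_) (foldr-tabulate (f ∘ suc))

prod-plus : ∀ {n} (ε : Fin n → Sign) → (∀ k → ε k ≡ plus) → prod ε ≡ plus
prod-plus {n} ε ε≡plus = trans (prod-cong ε≡plus) (prod-replicate-plus n)

prod-minusAt : ∀ {n} (ε : Fin n → Sign) (i : Fin n) →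
  ε i ≡ minus → (∀ k → k ≢ i → ε k ≡ plus) → prod ε ≡ minus
prod-minusAt {suc n} ε i εi≡minus rest≡plus = begin
  prod ε                        ≡⟨ prod-remove ε ⟩
  ε i · prod (ε ∘ punchIn i)    ≡⟨ cong₂ _·_ εi≡minus (prod-plus _ (λ k → rest≡plus _ (punchInᵢ≢i i k))) ⟩
  minus                         ∎
  where open ≡-Reasoning

underlying : ∀ {n} → SignedPerm n → Perm n
underlying η = proj₂ ∘ η

totalSign : ∀ {n} → SignedPerm n → Sign
totalSign η = prod (proj₁ ∘ η)

totalSign-⊙ : ∀ {n} (η θ : SignedPerm n) (π : Permutation′ n) →
  underlying θ ≗ π ⟨$⟩ʳ_ → totalSign (η ⊙ θ) ≡ totalSign θ · totalSign η
totalSign-⊙ η θ π θ≗π = begin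
  prod (λ k → proj₁ (θ k) · proj₁ (η (proj₂ (θ k))))  ≡⟨ prod-distrib-· (proj₁ ∘ θ) _ ⟩
  totalSign θ · prod (λ k → proj₁ (η (proj₂ (θ k))))  ≡⟨ cong (totalSign θ ·_) (prod-cong (cong (proj₁ ∘ η) ∘ θ≗π)) ⟩
  totalSign θ · prod (λ k → proj₁ (η (π ⟨$⟩ʳ k)))     ≡⟨ cong (totalSign θ ·_) (prod-permute (proj₁ ∘ η) π) ⟨
  totalSign θ · totalSign η                           ∎
  where open ≡-Reasoning

IsFullCyclic-resp-≗ : ∀ {n} .{{_ : NonZero n}} {f g : Perm n} → f ≗ g → IsFullCyclic f → IsFullCyclic g
IsFullCyclic-resp-≗ f≗g (σ , cyclic) = σ , λ k → trans (sym (f≗g _)) (cyclic k)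

signProd≡totalSign : ∀ {n} .{{_ : NonZero n}} (η : SignedPerm n) (σ : Permutation′ n) (ε : Fin n → Sign) →
  (∀ k → η (σ ⟨$⟩ʳ k) ≡ (ε k , σ ⟨$⟩ʳ next k)) → signProd ε ≡ totalSign η
signProd≡totalSign η σ ε cyclic = begin
  signProd ε                    ≡⟨ signProd≡prod ε ⟩
  prod ε                        ≡⟨ prod-cong (cong proj₁ ∘ cyclic) ⟨
  prod (proj₁ ∘ η ∘ (σ ⟨$⟩ʳ_))  ≡⟨ prod-permute (proj₁ ∘ η) σ ⟨
  totalSign η                   ∎
  where open ≡-Reasoning

isFullCyclicH⇔ : ∀ {n} .{{_ : NonZero n}} (η : SignedPerm n) (p : Sign) →
  IsFullCyclicH η p ⇔ (IsFullCyclic (underlying η) × totalSign η ≡ p)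
isFullCyclicH⇔ η p = mk⇔
  (λ (σ , ε , cyclic , ε≡p) →
    (σ , cong proj₂ ∘ cyclic) , trans (sym (signProd≡totalSign η σ ε cyclic)) ε≡p)
  (λ ((σ , cyclic) , sign≡p) →
    let ε = proj₁ ∘ η ∘ (σ ⟨$⟩ʳ_)
        signedCyclic k = cong (ε k ,_) (cyclic k)
    in σ , ε , signedCyclic , trans (signProd≡totalSign η σ ε signedCyclic) sign≡p)

swap≗transpose : ∀ {n} (i j : Fin n) → swap i j ≗ transpose i j ⟨$⟩ʳ_
swap≗transpose i j k with k ≟ i
... | yes _ = refl
... | no _ with k ≟ j
...   | yes _ = refl
...   | no _  = refl

underlying-tpos : ∀ {n} (i j : Fin n) → underlying (tpos i j) ≗ swap i j
underlying-tpos i j k with k ≟ i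
... | yes _ = refl
... | no _ with k ≟ j
...   | yes _ = refl
...   | no _  = refl

underlying-tneg : ∀ {n} (i j : Fin n) → underlying (tneg i j) ≗ swap i j
underlying-tneg i j k with k ≟ i
... | yes _ = refl
... | no _ with k ≟ j
...   | yes _ = refl
...   | no _  = refl

underlying-tloop : ∀ {n} (i : Fin n) → underlying (tloop i) ≗ id
underlying-tloop i k with k ≟ i
... | yes k≡i = sym k≡i
... | no _    = refl

tpos-sign : ∀ {n} (i j k : Fin n) → proj₁ (tpos i j k) ≡ plus
tpos-sign i j k with k ≟ i
... | yes _ = refl
... | no _ with k ≟ j
...   | yes _ = refl
...   | no _  = refl

tloop-sign-self : ∀ {n} (i : Fin n) → proj₁ (tloop i i) ≡ minus
tloop-sign-self i with i ≟ i
... | yes _   = refl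
... | no i≢i  = contradiction refl i≢i

tloop-sign-other : ∀ {n} (i k : Fin n) → k ≢ i → proj₁ (tloop i k) ≡ plus
tloop-sign-other i k k≢i with k ≟ i
... | yes k≡i = contradiction k≡i k≢i
... | no _    = refl

tneg-sign : ∀ {n} (i j k : Fin n) → i ≢ j → proj₁ (tneg i j k) ≡ proj₁ (tloop i k) · proj₁ (tloop j k)
tneg-sign i j k i≢j with k ≟ i
... | yes refl with k ≟ j
...   | yes refl = contradiction refl i≢j
...   | no _    = refl
tneg-sign i j k i≢j | no _ with k ≟ j
...   | yes _ = refl
...   | no _  = refl

totalSign-tloop : ∀ {n} (i : Fin n) → totalSign (tloop i) ≡ minus
totalSign-tloop i = prod-minusAt _ i (tloop-sign-self i) (tloop-sign-other i)

totalSign-tneg : ∀ {n} (i j : Fin n) → i ≢ j → totalSign (tneg i j) ≡ plus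
totalSign-tneg i j i≢j = begin
  totalSign (tneg i j)                                      ≡⟨ prod-cong (λ k → tneg-sign i j k i≢j) ⟩
  prod (λ k → proj₁ (tloop i k) · proj₁ (tloop j k))        ≡⟨ prod-distrib-· (proj₁ ∘ tloop i) _ ⟩
  totalSign (tloop i) · totalSign (tloop j)                 ≡⟨ cong₂ _·_ (totalSign-tloop i) (totalSign-tloop j) ⟩
  plus                                                      ∎
  where open ≡-Reasoning

WellFormed : ∀ {n} → SEdge n → Set
WellFormed (pos i j) = i ≢ j
WellFormed (neg i j) = i ≢ j
WellFormed (loop _)  = ⊤

edgeSign : ∀ {n} → SEdge n → Sign
edgeSign (pos _ _) = plus
edgeSign (neg _ _) = plus
edgeSign (loop _)  = minus

totalSign-τ : ∀ {n} (e : SEdge n) → WellFormed e → totalSign (τ e) ≡ edgeSign e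
totalSign-τ (pos i j) _   = prod-plus _ (tpos-sign i j)
totalSign-τ (neg i j) i≢j = totalSign-tneg i j i≢j
totalSign-τ (loop i)  _   = totalSign-tloop i

τ-permutation : ∀ {n} → SEdge n → Permutation′ n
τ-permutation (pos i j) = transpose i j
τ-permutation (neg i j) = transpose i j
τ-permutation (loop _)  = Permutation.id

underlying-τ : ∀ {n} (e : SEdge n) → underlying (τ e) ≗ τ-permutation e ⟨$⟩ʳ_
underlying-τ (pos i j) k = trans (underlying-tpos i j k) (swap≗transpose i j k)
underlying-τ (neg i j) k = trans (underlying-tneg i j k) (swap≗transpose i j k)
underlying-τ (loop i)  k = underlying-tloop i k

unsignedEdge : ∀ {n} → SEdge n → Maybe (Fin n × Fin n)
unsignedEdge (pos i j) = just (i , j)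
unsignedEdge (neg i j) = just (i , j)
unsignedEdge (loop _)  = nothing

loopVertex : ∀ {n} → SEdge n → Maybe (Fin n)
loopVertex (loop i) = just i
loopVertex _        = nothing

forget : ∀ {n} → List (SEdge n) → List (Fin n × Fin n)
forget = mapMaybe unsignedEdge

loopsOf : ∀ {n} → List (SEdge n) → List (Fin n)
loopsOf = mapMaybe loopVertex

underlying-πH : ∀ {n} (ω : List (SEdge n)) → underlying (πH ω) ≗ πS (forget ω)
underlying-πH []            k = refl
underlying-πH (pos i j ∷ ω) k = trans (underlying-πH ω _) (cong (πS (forget ω)) (underlying-tpos i j k))
underlying-πH (neg i j ∷ ω) k = trans (underlying-πH ω _) (cong (πS (forget ω)) (underlying-tneg i j k))
underlying-πH (loop i  ∷ ω) k = trans (underlying-πH ω _) (cong (πS (forget ω)) (underlying-tloop i k))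

signPow-loopsOf-∷ : ∀ {n} (e : SEdge n) ω →
  signPow (length (loopsOf (e ∷ ω))) ≡ edgeSign e · signPow (length (loopsOf ω))
signPow-loopsOf-∷ (pos _ _) ω = refl
signPow-loopsOf-∷ (neg _ _) ω = refl
signPow-loopsOf-∷ (loop _)  ω = refl

totalSign-πH : ∀ {n} (ω : List (SEdge n)) → All WellFormed ω → totalSign (πH ω) ≡ signPow (length (loopsOf ω))
totalSign-πH {n} [] [] = prod-plus {n} _ (λ _ → refl)
totalSign-πH (e ∷ ω) (wf ∷ wfs) = begin
  totalSign (πH ω ⊙ τ e)                     ≡⟨ totalSign-⊙ (πH ω) (τ e) (τ-permutation e) (underlying-τ e) ⟩
  totalSign (τ e) · totalSign (πH ω)         ≡⟨ cong₂ _·_ (totalSign-τ e wf) (totalSign-πH ω wfs) ⟩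
  edgeSign e · signPow (length (loopsOf ω))  ≡⟨ signPow-loopsOf-∷ e ω ⟨
  signPow (length (loopsOf (e ∷ ω)))         ∎
  where open ≡-Reasoning

signedEdge : ∀ {n} → Sign × (Fin n × Fin n) → SEdge n
signedEdge (plus  , e) = uncurry pos e
signedEdge (minus , e) = uncurry neg e

forget-map-signedEdge : ∀ {n} (xs : List (Sign × (Fin n × Fin n))) → forget (map signedEdge xs) ≡ map proj₂ xs
forget-map-signedEdge []                = refl
forget-map-signedEdge ((plus  , e) ∷ xs) = cong (e ∷_) (forget-map-signedEdge xs)
forget-map-signedEdge ((minus , e) ∷ xs) = cong (e ∷_) (forget-map-signedEdge xs)

map-proj₂-tag : ∀ {A : Set} (s : Sign) (xs : List A) → map proj₂ (map (s ,_) xs) ≡ xs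
map-proj₂-tag s xs = trans (sym (map-∘ xs)) (map-id xs)

module _ {n : ℕ} (G : SignedGraph n) where
  open SignedGraph G

  mapMaybe-edges : ∀ {B : Set} (f : SEdge n → Maybe B) →
    mapMaybe f (edges G) ≡ mapMaybe (f ∘ uncurry pos) Epos ++ mapMaybe (f ∘ uncurry neg) Eneg ++ mapMaybe (f ∘ loop) Loops
  mapMaybe-edges f = trans (mapMaybe-++ f (map (uncurry pos) Epos) _)
    (cong₂ _++_ (mapMaybe-map f _ Epos)
      (trans (mapMaybe-++ f (map (uncurry neg) Eneg) _) (cong₂ _++_ (mapMaybe-map f _ Eneg) (mapMaybe-map f loop Loops))))

  forget-edges : forget (edges G) ≡ unsignedEdges G
  forget-edges = trans (mapMaybe-edges unsignedEdge)
    (cong₂ _++_ (mapMaybe-just Epos) (trans (cong₂ _++_ (mapMaybe-just Eneg) (mapMaybe-nothing Loops)) (++-identityʳ Eneg)))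

  loopsOf-edges : loopsOf (edges G) ≡ Loops
  loopsOf-edges = trans (mapMaybe-edges loopVertex)
    (cong₂ _++_ (mapMaybe-nothing Epos) (cong₂ _++_ (mapMaybe-nothing Eneg) (mapMaybe-just Loops)))

  wellFormed-edges : All WellFormed (edges G)
  wellFormed-edges = All.++⁺ (All.map⁺ (All-map <⇒≢ Epos-<))
    (All.++⁺ (All.map⁺ (All-map <⇒≢ Eneg-<)) (All.map⁺ (universal (λ _ → tt) Loops)))

  totalSign-ordering : ∀ {ω} → ω ↭ edges G → totalSign (πH ω) ≡ signPow (length Loops)
  totalSign-ordering {ω} ρ = trans (totalSign-πH ω (All-resp-↭ (↭-sym ρ) wellFormed-edges))
    (cong signPow (trans (↭-length (mapMaybe-↭ loopVertex ρ)) (cong length loopsOf-edges)))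

  forget-ordering : ∀ {ω} → ω ↭ edges G → forget ω ↭ unsignedEdges G
  forget-ordering {ω} ρ = subst (forget ω ↭_) forget-edges (mapMaybe-↭ unsignedEdge ρ)

  -- Tagging each edge of Ḡ with its sign makes an ordering of Ḡ liftable along map proj₂.
  taggedEdges : List (Sign × (Fin n × Fin n))
  taggedEdges = map (plus ,_) Epos ++ map (minus ,_) Eneg

  map-proj₂-taggedEdges : map proj₂ taggedEdges ≡ unsignedEdges G
  map-proj₂-taggedEdges = trans (map-++ proj₂ (map (plus ,_) Epos) _)
    (cong₂ _++_ (map-proj₂-tag plus Epos) (map-proj₂-tag minus Eneg))

  map-signedEdge-taggedEdges : map signedEdge taggedEdges ++ map loop Loops ≡ edges G
  map-signedEdge-taggedEdges = trans
    (cong (_++ map loop Loops) (trans (map-++ signedEdge (map (plus ,_) Epos) _)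
      (cong₂ _++_ (sym (map-∘ Epos)) (sym (map-∘ Eneg)))))
    (++-assoc (map (uncurry pos) Epos) _ _)

  lift-ordering : ∀ {ω′} → ω′ ↭ unsignedEdges G → Σ[ ω ∈ List (SEdge n) ] (ω ↭ edges G × forget ω ≡ ω′)
  lift-ordering {ω′} ρ′
    with tagged , ω′≡ , taggedEdges↭ ← ↭-map-inv proj₂ (subst (_↭ ω′) (sym map-proj₂-taggedEdges) (↭-sym ρ′))
    = ω , ρ , forget-ω
    where
    ω : List (SEdge n)
    ω = map signedEdge tagged ++ map loop Loops

    ρ : ω ↭ edges G
    ρ = subst (ω ↭_) map-signedEdge-taggedEdges (++⁺ʳ (map loop Loops) (map⁺ signedEdge (↭-sym taggedEdges↭)))

    forget-ω : forget ω ≡ ω′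
    forget-ω = begin
      forget ω                                                   ≡⟨ mapMaybe-++ unsignedEdge (map signedEdge tagged) _ ⟩
      forget (map signedEdge tagged) ++ forget (map loop Loops)  ≡⟨ cong₂ _++_ (forget-map-signedEdge tagged)
                                                                     (trans (mapMaybe-map unsignedEdge loop Loops) (mapMaybe-nothing Loops)) ⟩
      map proj₂ tagged ++ []                                     ≡⟨ ++-identityʳ _ ⟩
      map proj₂ tagged                                           ≡⟨ ω′≡ ⟨
      ω′                                                         ∎
      where open ≡-Reasoning

theorem1p8 : ∀ (n : ℕ) .{{_ : NonZero n}} (G : SignedGraph n) (p : Sign) →
    (Σ[ ω ∈ List (SEdge n) ] (ω ↭ edges G × IsFullCyclicH (πH ω) p))
    ⇔ ((Σ[ ω ∈ List (Fin n × Fin n) ] (ω ↭ unsignedEdges G × IsFullCyclic (πS ω)))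
       × signPow (length (SignedGraph.Loops G)) ≡ p)
theorem1p8 n G p = mk⇔
  (λ (ω , ρ , cyclic) →
    let cyclicS , sign≡p = Equivalence.to (isFullCyclicH⇔ (πH ω) p) cyclic
    in (forget ω , forget-ordering G ρ , IsFullCyclic-resp-≗ (underlying-πH ω) cyclicS)
       , trans (sym (totalSign-ordering G ρ)) sign≡p)
  (λ ((ω′ , ρ′ , cyclic) , loops≡p) →
    let ω , ρ , forget-ω = lift-ordering G ρ′
        underlying≗πS k = trans (underlying-πH ω k) (cong (λ l → πS l k) forget-ω)
    in ω , ρ , Equivalence.from (isFullCyclicH⇔ (πH ω) p)
         (IsFullCyclic-resp-≗ (sym ∘ underlying≗πS) cyclic , trans (totalSign-ordering G ρ) loops≡p))
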